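{- Let $G$ be a group and let $X_1,X_2$ be finite $G$-sets. Then for $i=1,2$ there are $G$-sets $Y_i$ and $G$-maps $h_i:X_i\to Y_i$ such that (1) $Y_1$ and $Y_2$ have the same Galois closure, and (2) $h_1\times h_2:X_1\times X_2\to Y_1\times Y_2$ induces a bijection between the set of $G$-orbits of $X_1\times X_2$ and the set of $G$-orbits of $Y_1\times Y_2$ (with diagonal action).
   Context: A normal subgroup $N\trianglelefteq G$ is a normal stabilizer of a $G$-set $X$ if $N$ fixes every point of $X$. The Galois group of $X$ is its maximal normal stabilizer. Two $G$-sets have the same Galois closure if they have the same Galois group. A $G$-map sends orbits onto orbits, giving a well-defined map on orbit sets. -}

module Defs where

open import Level using (Level; _⊔_; suc)
open import Algebra.Bundles using (Group)
open import Relation.Binary.Bundles using (Setoid)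
open import Relation.Binary.PropositionalEquality as ≡ using (_≡_)
open import Relation.Unary using (Pred; _⊆_)
open import Function.Bundles using (Func; Bijection)
open import Data.Nat using (ℕ)
open import Data.Fin using (Fin)
open import Data.Product.Relation.Binary.Pointwise.NonDependent using (×-setoid)
open import Data.Product using (Σ; ∃; _×_; _,_; proj₁; proj₂)

module _ {c ℓ : Level} (G : Group c ℓ) where
  private module G = Group G

  record GSet (a b : Level) : Set (c ⊔ ℓ ⊔ suc (a ⊔ b)) where
    field
      setoid : Setoid a b
    open Setoid setoid public renaming (Carrier to Pt; _≈_ to _≈ₓ_)
    field
      act      : G.Carrier → Pt → Pt
      act-cong : ∀ {g h x y} → g G.≈ h → x ≈ₓ y → act g x ≈ₓ act h y
      act-id   : ∀ x → act G.ε x ≈ₓ x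
      act-comp : ∀ g h x → act (g G.∙ h) x ≈ₓ act g (act h x)

  open GSet

  IsFinite : ∀ {a b} → GSet a b → Set (a ⊔ b)
  IsFinite X = Σ ℕ λ n → Bijection (≡.setoid (Fin n)) (setoid X)

  record GMap {a b a' b'} (X : GSet a b) (Y : GSet a' b')
         : Set (c ⊔ a ⊔ b ⊔ a' ⊔ b') where
    field
      fun       : Pt X → Pt Y
      fun-cong  : ∀ {x y} → _≈ₓ_ X x y → _≈ₓ_ Y (fun x) (fun y)
      equivar   : ∀ g x → _≈ₓ_ Y (fun (act X g x)) (act Y g (fun x))
  open GMap

  _⊗_ : ∀ {a b a' b'} → GSet a b → GSet a' b' → GSet (a ⊔ a') (b ⊔ b')
  X ⊗ Y = record
    { setoid   = ×-setoid'
    ; act      = λ g p → act X g (proj₁ p) , act Y g (proj₂ p)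
    ; act-cong = λ g≈h p≈q → act-cong X g≈h (proj₁ p≈q) , act-cong Y g≈h (proj₂ p≈q)
    ; act-id   = λ p → act-id X (proj₁ p) , act-id Y (proj₂ p)
    ; act-comp = λ g h p → act-comp X g h (proj₁ p) , act-comp Y g h (proj₂ p)
    }
    where ×-setoid' = ×-setoid (setoid X) (setoid Y)

  SameOrbit : ∀ {a b} (X : GSet a b) → Pt X → Pt X → Set (c ⊔ b)
  SameOrbit X x y = ∃ λ g → _≈ₓ_ X (act X g x) y

  -- The map on orbit sets induced by a map f : X → Y (well defined for a
  -- G-map) is a bijection: surjective and injective on orbits.
  InducesOrbitBijection : ∀ {a b a' b'} (X : GSet a b) (Y : GSet a' b')
                          → (Pt X → Pt Y) → Set (c ⊔ a ⊔ b ⊔ a' ⊔ b')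
  InducesOrbitBijection X Y f =
      (∀ y → ∃ λ x → SameOrbit Y (f x) y)
    × (∀ x x' → SameOrbit Y (f x) (f x') → SameOrbit X x x')

  record IsNormalSubgroup {p} (N : Pred G.Carrier p) : Set (c ⊔ ℓ ⊔ p) where
    field
      resp  : ∀ {g h} → g G.≈ h → N g → N h
      ε∈    : N G.ε
      ∙∈    : ∀ {g h} → N g → N h → N (g G.∙ h)
      ⁻¹∈   : ∀ {g} → N g → N (g G.⁻¹)
      conj∈ : ∀ {n} g → N n → N ((g G.∙ n) G.∙ (g G.⁻¹))

  IsNormalStabilizer : ∀ {p a b} → Pred G.Carrier p → GSet a b → Set (c ⊔ ℓ ⊔ p ⊔ a ⊔ b)
  IsNormalStabilizer N X = IsNormalSubgroup N × (∀ {g} → N g → ∀ x → _≈ₓ_ X (act X g x) x)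

  -- N is the Galois group of X: the maximal normal stabilizer (maximal
  -- among normal stabilizers given by predicates of the same level p).
  IsGaloisGroup : ∀ {p a b} → Pred G.Carrier p → GSet a b → Set (c ⊔ ℓ ⊔ suc p ⊔ a ⊔ b)
  IsGaloisGroup {p} N X =
    IsNormalStabilizer N X × ((M : Pred G.Carrier p) → IsNormalStabilizer M X → M ⊆ N)

  -- Y₁ and Y₂ have the same Galois closure: they have the same Galois group.
  SameGaloisClosure : ∀ {a b a' b'} (p : Level) → GSet a b → GSet a' b'
                      → Set (c ⊔ ℓ ⊔ suc p ⊔ a ⊔ b ⊔ a' ⊔ b')
  SameGaloisClosure p Y₁ Y₂ =
    Σ (Pred G.Carrier p) λ N → IsGaloisGroup N Y₁ × IsGaloisGroup N Y₂

-- Identify x, x' ∈ X₁ when (x , x₂) and (x' , x₂) lie in the same orbit for every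
-- x₂ ∈ X₂, and call the quotient Y₁; define Y₂ symmetrically.  The orbit of
-- (x₁ , x₂) depends only on the classes of x₁ and x₂, which gives the bijection on
-- orbits.  An element g acts trivially on Y₁ iff (g x₁ , x₂) ~ (x₁ , x₂) for all
-- x₁, x₂; since (g x₁ , x₂) ~ (x₁ , g⁻¹ x₂) and the kernel is closed under inverses,
-- this condition is symmetric in X₁ and X₂.  So Y₁ and Y₂ have the same kernel,
-- which is the Galois group of each.
module Submission where

open import Defs
open import Level using (Level; _⊔_; Lift; lift; lower)
open import Algebra.Bundles using (Group)
open import Data.Product using (Σ; _×_; _,_; proj₁; proj₂)
open import Function using (id)
open import Relation.Binary.Core using (Rel; _⇒_; _=[_]⇒_)
open import Relation.Binary.Structures using (IsEquivalence)
open import Relation.Unary using (Pred; _⊆_; _≐_)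

module _ {c ℓ : Level} (G : Group c ℓ) where
  private module G = Group G
  open GSet using (Pt; _≈ₓ_; act)

  module _ {a b} (Z : GSet G a b) where
    private module Z = GSet Z

    act-inverseʳ : ∀ g z → act Z g (act Z (g G.⁻¹) z) Z.≈ₓ z
    act-inverseʳ g z = Z.trans (Z.sym (Z.act-comp g (g G.⁻¹) z))
      (Z.trans (Z.act-cong (G.inverseʳ g) Z.refl) (Z.act-id z))

    act-inverseˡ : ∀ g z → act Z (g G.⁻¹) (act Z g z) Z.≈ₓ z
    act-inverseˡ g z = Z.trans (Z.sym (Z.act-comp (g G.⁻¹) g z))
      (Z.trans (Z.act-cong (G.inverseˡ g) Z.refl) (Z.act-id z))

    ≈⇒sameOrbit : ∀ {z w} → z Z.≈ₓ w → SameOrbit G Z z w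
    ≈⇒sameOrbit {z} z≈w = G.ε , Z.trans (Z.act-id z) z≈w

    sameOrbit-refl : ∀ {z} → SameOrbit G Z z z
    sameOrbit-refl = ≈⇒sameOrbit Z.refl

    sameOrbit-sym : ∀ {z w} → SameOrbit G Z z w → SameOrbit G Z w z
    sameOrbit-sym {z} (g , gz≈w) =
      g G.⁻¹ , Z.trans (Z.act-cong G.refl (Z.sym gz≈w)) (act-inverseˡ g z)

    sameOrbit-trans : ∀ {z w v} → SameOrbit G Z z w → SameOrbit G Z w v → SameOrbit G Z z v
    sameOrbit-trans {z} (g , gz≈w) (h , hw≈v) =
      h G.∙ g , Z.trans (Z.act-comp h g z) (Z.trans (Z.act-cong G.refl gz≈w) hw≈v)

    Kernel : Pred G.Carrier (a ⊔ b)
    Kernel g = ∀ z → act Z g z Z.≈ₓ z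

    kernel-isNormalSubgroup : IsNormalSubgroup G Kernel
    kernel-isNormalSubgroup = record
      { resp  = λ g≈h gz≈z z → Z.trans (Z.act-cong (G.sym g≈h) Z.refl) (gz≈z z)
      ; ε∈    = Z.act-id
      ; ∙∈    = λ {g} {h} gz≈z hz≈z z →
          Z.trans (Z.act-comp g h z) (Z.trans (Z.act-cong G.refl (hz≈z z)) (gz≈z _))
      ; ⁻¹∈   = λ {g} gz≈z z → Z.trans (Z.sym (gz≈z _)) (act-inverseʳ g z)
      ; conj∈ = λ {n} g nz≈z z →
          Z.trans (Z.act-comp (g G.∙ n) (g G.⁻¹) z)
            (Z.trans (Z.act-comp g n _)
              (Z.trans (Z.act-cong G.refl (nz≈z _)) (act-inverseʳ g z)))
      }

  kernel-isGaloisGroup : ∀ {a b} (Y Z : GSet G a b)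
    → Kernel Y ≐ Kernel Z → IsGaloisGroup G (Kernel Y) Z
  kernel-isGaloisGroup Y Z (Y⊆Z , Z⊆Y) =
    (kernel-isNormalSubgroup Y , Y⊆Z) , λ _ (_ , M⊆Z) Mg → Z⊆Y (M⊆Z Mg)

  sameGaloisClosure : ∀ {a b} (Y Z : GSet G a b)
    → Kernel Y ≐ Kernel Z → SameGaloisClosure G (a ⊔ b) Y Z
  sameGaloisClosure Y Z kernels-eq =
    Kernel Y , kernel-isGaloisGroup Y Y (id , id) , kernel-isGaloisGroup Y Z kernels-eq

  record IsInvariantEquivalence {a b r} (X : GSet G a b) (R : Rel (Pt X) r)
         : Set (c ⊔ a ⊔ b ⊔ r) where
    field
      isEquivalence : IsEquivalence R
      ≈⇒R           : _≈ₓ_ X ⇒ R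
      act-resp      : ∀ g → R =[ act X g ]⇒ R

  -- The levels a' and r' only raise the universe of the quotient.
  module _ {a b r} (a' r' : Level) (X : GSet G a b) {R : Rel (Pt X) r}
           (invariant : IsInvariantEquivalence X R) where
    open IsInvariantEquivalence invariant
    private module R = IsEquivalence isEquivalence
    private module X = GSet X

    quotient : GSet G (a ⊔ a') (r ⊔ r')
    quotient = record
      { setoid   = record
        { Carrier       = Lift a' (Pt X)
        ; _≈_           = λ u v → Lift r' (R (lower u) (lower v))
        ; isEquivalence = record
          { refl  = lift R.refl
          ; sym   = λ uRv → lift (R.sym (lower uRv))
          ; trans = λ uRv vRw → lift (R.trans (lower uRv) (lower vRw))
          }
        }
      ; act      = λ g u → lift (act X g (lower u))
      ; act-cong = λ {g} g≈h uRv →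
          lift (R.trans (act-resp g (lower uRv)) (≈⇒R (X.act-cong g≈h X.refl)))
      ; act-id   = λ u → lift (≈⇒R (X.act-id (lower u)))
      ; act-comp = λ g h u → lift (≈⇒R (X.act-comp g h (lower u)))
      }

    quotient-map : GMap G X quotient
    quotient-map = record
      { fun      = lift
      ; fun-cong = λ x≈y → lift (≈⇒R x≈y)
      ; equivar  = λ _ _ → lift R.refl
      }

  module _ {a₁ b₁ a₂ b₂} (X₁ : GSet G a₁ b₁) (X₂ : GSet G a₂ b₂) where
    private
      module X₂ = GSet X₂

      X₁×X₂ : GSet G (a₁ ⊔ a₂) (b₁ ⊔ b₂)
      X₁×X₂ = _⊗_ G X₁ X₂

    sameOrbit-swap : ∀ {x₁ x₂ y₁ y₂}
      → SameOrbit G X₁×X₂ (x₁ , x₂) (y₁ , y₂)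
      → SameOrbit G (_⊗_ G X₂ X₁) (x₂ , x₁) (y₂ , y₁)
    sameOrbit-swap (g , (gx₁≈y₁ , gx₂≈y₂)) = g , (gx₂≈y₂ , gx₁≈y₁)

    sameOrbit-shift : ∀ g x₁ x₂
      → SameOrbit G X₁×X₂ (act X₁ g x₁ , x₂) (x₁ , act X₂ (g G.⁻¹) x₂)
    sameOrbit-shift g x₁ x₂ = g G.⁻¹ , (act-inverseˡ X₁ g x₁ , X₂.refl)

    Indistinguishable : Rel (Pt X₁) (c ⊔ a₂ ⊔ b₁ ⊔ b₂)
    Indistinguishable x y = ∀ x₂ → SameOrbit G X₁×X₂ (x , x₂) (y , x₂)

    indistinguishable-isInvariantEquivalence : IsInvariantEquivalence X₁ Indistinguishable
    indistinguishable-isInvariantEquivalence = record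
      { isEquivalence = record
        { refl  = λ _ → sameOrbit-refl X₁×X₂
        ; sym   = λ x~y x₂ → sameOrbit-sym X₁×X₂ (x~y x₂)
        ; trans = λ x~y y~z x₂ → sameOrbit-trans X₁×X₂ (x~y x₂) (y~z x₂)
        }
      ; ≈⇒R      = λ x≈y _ → ≈⇒sameOrbit X₁×X₂ (x≈y , X₂.refl)
      ; act-resp = λ g {x} {y} x~y x₂ →
          sameOrbit-trans X₁×X₂ (sameOrbit-shift g x x₂)
            (sameOrbit-trans X₁×X₂ (x~y _)
              (sameOrbit-sym X₁×X₂ (sameOrbit-shift g y x₂)))
      }

  module _ {a b} (X₁ X₂ : GSet G a b) where

    Reduced : GSet G (c ⊔ ℓ ⊔ a ⊔ b) (c ⊔ ℓ ⊔ a ⊔ b)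
    Reduced =
      quotient (c ⊔ ℓ ⊔ b) ℓ X₁ (indistinguishable-isInvariantEquivalence X₁ X₂)

    reduced-map : GMap G X₁ Reduced
    reduced-map =
      quotient-map (c ⊔ ℓ ⊔ b) ℓ X₁ (indistinguishable-isInvariantEquivalence X₁ X₂)

  module _ {a b} (X₁ X₂ : GSet G a b) where
    private
      X₁×X₂ : GSet G a b
      X₁×X₂ = _⊗_ G X₁ X₂

      Y₁ Y₂ : GSet G (c ⊔ ℓ ⊔ a ⊔ b) (c ⊔ ℓ ⊔ a ⊔ b)
      Y₁ = Reduced X₁ X₂
      Y₂ = Reduced X₂ X₁

    kernel-reduced-⊆ : Kernel Y₁ ⊆ Kernel Y₂
    kernel-reduced-⊆ {g} g∈ker (lift x₂) = lift λ x₁ →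
      sameOrbit-trans (_⊗_ G X₂ X₁) (sameOrbit-shift X₂ X₁ g x₂ x₁)
        (sameOrbit-swap X₁ X₂ (lower (g⁻¹∈ker (lift x₁)) x₂))
      where
      g⁻¹∈ker : Kernel Y₁ (g G.⁻¹)
      g⁻¹∈ker = IsNormalSubgroup.⁻¹∈ (kernel-isNormalSubgroup Y₁) g∈ker

    reduced-inducesOrbitBijection :
      InducesOrbitBijection G X₁×X₂ (_⊗_ G Y₁ Y₂)
        (λ p → lift (proj₁ p) , lift (proj₂ p))
    reduced-inducesOrbitBijection =
        (λ (u₁ , u₂) → (lower u₁ , lower u₂) , sameOrbit-refl (_⊗_ G Y₁ Y₂))
      , λ (x₁ , x₂) (y₁ , y₂) (g , (gx₁~y₁ , gx₂~y₂)) →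
          sameOrbit-trans X₁×X₂ (g , GSet.refl X₁×X₂)
            (sameOrbit-trans X₁×X₂ (lower gx₁~y₁ _)
              (sameOrbit-swap X₂ X₁ (lower gx₂~y₂ y₁)))

theorem2p6 : {c ℓ a b : Level} (G : Group c ℓ)
    → (X₁ X₂ : GSet G a b) → IsFinite G X₁ → IsFinite G X₂
    → Σ (GSet G (c ⊔ ℓ ⊔ a ⊔ b) (c ⊔ ℓ ⊔ a ⊔ b)) λ Y₁
    → Σ (GSet G (c ⊔ ℓ ⊔ a ⊔ b) (c ⊔ ℓ ⊔ a ⊔ b)) λ Y₂
    → Σ (GMap G X₁ Y₁) λ h₁
    → Σ (GMap G X₂ Y₂) λ h₂
    → SameGaloisClosure G (c ⊔ ℓ ⊔ a ⊔ b) Y₁ Y₂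
      × InducesOrbitBijection G (_⊗_ G X₁ X₂) (_⊗_ G Y₁ Y₂)
          (λ p → GMap.fun h₁ (proj₁ p) , GMap.fun h₂ (proj₂ p))
theorem2p6 G X₁ X₂ _ _ =
    Reduced G X₁ X₂ , Reduced G X₂ X₁ , reduced-map G X₁ X₂ , reduced-map G X₂ X₁
  , sameGaloisClosure G (Reduced G X₁ X₂) (Reduced G X₂ X₁)
      (kernel-reduced-⊆ G X₁ X₂ , kernel-reduced-⊆ G X₂ X₁)
  , reduced-inducesOrbitBijection G X₁ X₂
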